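{- For every integer $n\ge 3$, the disjunctive domination number of the torus grid graph $C_3\Box C_n$ is $$\gamma_2^d(C_3\Box C_n)=\left\lceil\frac{n}{2}\right\rceil.$$
   Context: $C_k$ denotes the cycle on $k$ vertices. For graphs $G,H$, the Cartesian product $G\Box H$ has vertex set $V(G)\times V(H)$, with $(g,h)$ adjacent to $(g',h')$ iff either $g=g'$ and $hh'\in E(H)$, or $h=h'$ and $gg'\in E(G)$. For a graph $\Gamma$ and a vertex $v$, let $\Gamma(v)$ be the set of vertices at distance exactly $1$ from $v$ and $\Gamma_2(v)$ the set of vertices at distance exactly $2$ from $v$. A set $S\subseteq V(\Gamma)$ is a disjunctive dominating set if every vertex $v\notin S$ satisfies $|\Gamma(v)\cap S|\ge 1$ or $|\Gamma_2(v)\cap S|\ge 2$. The disjunctive domination number $\gamma_2^d(\Gamma)$ is the minimum cardinality of a disjunctive dominating set of $\Gamma$. -}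

module Defs where

open import Data.Nat using (ℕ; zero; suc; _+_; _*_; _≤_; _/_)
open import Data.Fin using (Fin; toℕ; remQuot)
open import Data.Fin.Subset using (Subset; _∈_; _∉_; ∣_∣)
open import Data.Product using (_×_; Σ; ∃; ∃-syntax; _,_)
open import Data.Sum using (_⊎_)
open import Relation.Nullary using (¬_)
open import Relation.Binary.PropositionalEquality using (_≡_; _≢_)

-- A graph on vertex set Fin n, given by its adjacency relation.
-- (The concrete graphs below, C_m for m ≥ 3 and their Cartesian product,
-- are simple: the relation is irreflexive and symmetric.)
record Graph (n : ℕ) : Set₁ where
  field
    Adj : Fin n → Fin n → Set
open Graph public

data Walk {n : ℕ} (G : Graph n) : ℕ → Fin n → Fin n → Set where
  [] : ∀ {u} → Walk G zero u u
  _∷_ : ∀ {k u v w} → Adj G u v → Walk G k v w → Walk G (suc k) u w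

DistLe : ∀ {n} → Graph n → ℕ → Fin n → Fin n → Set
DistLe G d u v = ∃[ k ] (k ≤ d × Walk G k u v)

DistEq : ∀ {n} → Graph n → ℕ → Fin n → Fin n → Set
DistEq G zero u v = DistLe G zero u v
DistEq G (suc d) u v = DistLe G (suc d) u v × ¬ DistLe G d u v

Disjunctive : ∀ {n} → Graph n → Subset n → Set
Disjunctive {n} G S =
  ∀ (v : Fin n) → v ∉ S →
    (∃[ u ] (u ∈ S × DistEq G 1 v u))
    ⊎ (∃[ u ] ∃[ w ] (u ≢ w × u ∈ S × w ∈ S × DistEq G 2 v u × DistEq G 2 v w))

DisjDomNumber : ∀ {n} → Graph n → ℕ → Set
DisjDomNumber {n} G k =
  (∃[ S ] (Disjunctive G S × ∣ S ∣ ≡ k))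
  × (∀ (S : Subset n) → Disjunctive G S → k ≤ ∣ S ∣)

CycleAdj : (m : ℕ) → Fin m → Fin m → Set
CycleAdj m i j = (suc (toℕ i) ≡ toℕ j) ⊎ (suc (toℕ j) ≡ toℕ i)
               ⊎ (suc (toℕ i) ≡ m × toℕ j ≡ 0) ⊎ (suc (toℕ j) ≡ m × toℕ i ≡ 0)

Cycle : (m : ℕ) → Graph m
Cycle m = record { Adj = CycleAdj m }

_□_ : ∀ {m n} → Graph m → Graph n → Graph (m * n)
_□_ {m} {n} G H = record { Adj = λ i j → ProdAdj (remQuot n i) (remQuot n j) }
  where
  ProdAdj : Fin m × Fin n → Fin m × Fin n → Set
  ProdAdj (g , h) (g′ , h′) = (g ≡ g′ × Adj H h h′) ⊎ (h ≡ h′ × Adj G g g′)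

-- Read C₃ □ Cₙ as n columns of three cells.  One row of cells taken at every
-- other column is disjunctively dominating and has ⌈n/2⌉ elements.
--
-- Conversely, whether the cell in row g of column x + 2 is dominated depends only
-- on the five columns x, …, x + 4.  A potential on four consecutive columns,
-- found by computer, satisfies
--   1 + potential c₀ c₁ c₂ c₃ ≤ 2 |c₄| + potential c₁ c₂ c₃ c₄
-- on every window of five columns whose middle column is dominated; this is
-- checked exhaustively over the 8⁵ windows.  Summed around the cycle, the
-- potentials telescope and leave n ≤ 2 |S|.
module Submission where

open import Defs
open import Data.Nat
  using (ℕ; zero; suc; _+_; _*_; _/_; _%_; _⊓_; _≤_; _<_; _≤ᵇ_; z≤n; s≤s; NonZero; ⌊_/2⌋; ⌈_/2⌉)
open import Data.Nat.Properties
  using ( +-0-commutativeMonoid; +-assoc; +-comm; +-identityʳ; +-mono-≤; +-cancelʳ-≡; +-cancelʳ-≤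
        ; ≤-trans; ≤-reflexive; m≤n+m; <⇒≤; 1+n≢n; m≢1+n+m; m≤n⇒m<n∨m≡n; <-irrefl; suc-injective
        ; ≤ᵇ⇒≤; ≤⇒≤ᵇ
        ; ⌈n/2⌉-mono; n≡⌈n+n/2⌉; module ≤-Reasoning)
open import Data.Nat.DivMod
  using (_mod_; m%n<n; m<n⇒m%n≡m; n%n≡0; [m+n]%n≡m%n; %-distribˡ-+; m%n%n≡m%n; m/n≡1+[m∸n]/n)
open import Data.Nat.ListAction using (sum)
open import Data.Bool using (Bool; true; false; _∧_; _∨_; not; T)
open import Data.Bool.Properties using (T-∧; T-∨)
open import Data.Unit using (tt)
open import Data.Empty using (⊥-elim)
open import Data.Product using (_×_; ∃-syntax; _,_; proj₁; proj₂; uncurry)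
open import Data.Sum using (_⊎_; inj₁; inj₂; [_,_]′) renaming (map to ⊎-map)
open import Data.Fin as Fin
  using (Fin; toℕ; fromℕ; fromℕ<; inject₁; combine; remQuot; quotient; remainder; _↑ˡ_; _↑ʳ_)
open import Data.Fin.Patterns using (0F; 1F; 2F)
open import Data.Fin.Properties
  using ( toℕ-injective; toℕ<n; toℕ-fromℕ<; toℕ-inject₁; toℕ-fromℕ
        ; remQuot-combine; combine-remQuot; combine-injectiveˡ; combine-injectiveʳ)
open import Data.Fin.Subset using (Subset; _∈_; _∉_; ∣_∣)
open import Data.Fin.Subset.Properties using (_∈?_)
open import Data.Vec using ([]; _∷_; lookup; tabulate)
open import Data.Vec.Properties using ([]=⇒lookup; lookup⇒[]=; lookup∘tabulate)
open import Data.List using (List; map; _++_) renaming ([] to []ₗ; _∷_ to _∷ₗ_)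
open import Data.List.Relation.Unary.Any using (here; there)
open import Data.List.Membership.Propositional using () renaming (_∈_ to _∈ₗ_)
open import Data.List.Membership.Propositional.Properties using (∈-++⁺ˡ; ∈-++⁺ʳ)
open import Function using (_∘_; Equivalence)
open import Relation.Nullary using (¬_; yes; no; contradiction)
open import Relation.Binary.PropositionalEquality
open import Algebra.Properties.CommutativeMonoid.Sum +-0-commutativeMonoid
  using (sum-syntax; sum-cong-≗; sum-init-last; ∑-distrib-+; ∑-comm)

𝟙 : Bool → ℕ
𝟙 true = 1
𝟙 false = 0

ones : List Bool → ℕ
ones bs = sum (map 𝟙 bs)

module _ {A : Set} (f : A → Bool) where

  ∈⇒1≤ones : ∀ {x xs} → x ∈ₗ xs → f x ≡ true → 1 ≤ ones (map f xs)
  ∈⇒1≤ones (here refl) fx = +-mono-≤ (≤-reflexive (cong 𝟙 (sym fx))) z≤n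
  ∈⇒1≤ones {xs = y ∷ₗ _} (there x∈xs) fx = ≤-trans (∈⇒1≤ones x∈xs fx) (m≤n+m _ (𝟙 (f y)))

  ∈∈⇒2≤ones : ∀ {x y xs} → x ∈ₗ xs → y ∈ₗ xs → x ≢ y → f x ≡ true → f y ≡ true →
              2 ≤ ones (map f xs)
  ∈∈⇒2≤ones (here refl) (here refl) x≢y _ _ = contradiction refl x≢y
  ∈∈⇒2≤ones (here refl) (there y∈xs) _ fx fy =
    +-mono-≤ (≤-reflexive (cong 𝟙 (sym fx))) (∈⇒1≤ones y∈xs fy)
  ∈∈⇒2≤ones (there x∈xs) (here refl) _ fx fy =
    +-mono-≤ (≤-reflexive (cong 𝟙 (sym fy))) (∈⇒1≤ones x∈xs fx)
  ∈∈⇒2≤ones {xs = z ∷ₗ _} (there x∈xs) (there y∈xs) x≢y fx fy =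
    ≤-trans (∈∈⇒2≤ones x∈xs y∈xs x≢y fx fy) (m≤n+m _ (𝟙 (f z)))

∑-1 : ∀ n → ∑[ j < n ] 1 ≡ n
∑-1 zero = refl
∑-1 (suc n) = cong suc (∑-1 n)

∑-mono-≤ : ∀ {n} {f g : Fin n → ℕ} → (∀ j → f j ≤ g j) → ∑[ j < n ] f j ≤ ∑[ j < n ] g j
∑-mono-≤ {zero} f≤g = z≤n
∑-mono-≤ {suc n} f≤g = +-mono-≤ (f≤g Fin.zero) (∑-mono-≤ (f≤g ∘ Fin.suc))

∑-rotate : ∀ n (f : ℕ → ℕ) → f n ≡ f 0 → ∑[ j < n ] f (suc (toℕ j)) ≡ ∑[ j < n ] f (toℕ j)
∑-rotate n f fn≡f0 = +-cancelʳ-≡ (f 0) _ _ (begin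
  ∑[ j < n ] f (suc (toℕ j)) + f 0                    ≡⟨ +-comm _ (f 0) ⟩
  ∑[ j < suc n ] f (toℕ j)                            ≡⟨ sum-init-last (f ∘ toℕ) ⟩
  ∑[ j < n ] f (toℕ (inject₁ j)) + f (toℕ (fromℕ n))  ≡⟨ cong₂ _+_ (sum-cong-≗ {n} (cong f ∘ toℕ-inject₁))
                                                                  (cong f (toℕ-fromℕ n)) ⟩
  ∑[ j < n ] f (toℕ j) + f n                          ≡⟨ cong (∑[ j < n ] f (toℕ j) +_) fn≡f0 ⟩
  ∑[ j < n ] f (toℕ j) + f 0                          ∎)
  where open ≡-Reasoning

Periodic : ℕ → (ℕ → ℕ) → Set
Periodic n f = ∀ x → f (x + n) ≡ f x

∑-shift : ∀ {n f} → Periodic n f → ∀ k → ∑[ j < n ] f (k + toℕ j) ≡ ∑[ j < n ] f (toℕ j)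
∑-shift per zero = refl
∑-shift {n} {f} per (suc k) = trans (∑-shift {f = f ∘ suc} (per ∘ suc) k) (∑-rotate n f (per 0))

potential-argument : ∀ n (ψ c : ℕ → ℕ) → ψ n ≡ ψ 0 → (∀ x → suc (ψ x) ≤ c x + ψ (suc x)) →
                     n ≤ ∑[ j < n ] c (toℕ j)
potential-argument n ψ c ψn≡ψ0 step = +-cancelʳ-≤ (∑[ j < n ] ψ (toℕ j)) n _ (begin
  n + ∑[ j < n ] ψ (toℕ j)                           ≡⟨ cong (_+ ∑[ j < n ] ψ (toℕ j)) (∑-1 n) ⟨
  ∑[ j < n ] 1 + ∑[ j < n ] ψ (toℕ j)                ≡⟨ ∑-distrib-+ {n} (λ _ → 1) (ψ ∘ toℕ) ⟨
  ∑[ j < n ] suc (ψ (toℕ j))                         ≤⟨ ∑-mono-≤ {n} (step ∘ toℕ) ⟩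
  ∑[ j < n ] (c (toℕ j) + ψ (suc (toℕ j)))           ≡⟨ ∑-distrib-+ {n} (c ∘ toℕ) (ψ ∘ suc ∘ toℕ) ⟩
  ∑[ j < n ] c (toℕ j) + ∑[ j < n ] ψ (suc (toℕ j))  ≡⟨ cong (∑[ j < n ] c (toℕ j) +_) (∑-rotate n ψ ψn≡ψ0) ⟩
  ∑[ j < n ] c (toℕ j) + ∑[ j < n ] ψ (toℕ j)        ∎)
  where open ≤-Reasoning

∑-↑ : ∀ m {k} (f : Fin (m + k) → ℕ) →
      ∑[ i < m + k ] f i ≡ ∑[ i < m ] f (i ↑ˡ k) + ∑[ j < k ] f (m ↑ʳ j)
∑-↑ zero f = refl
∑-↑ (suc m) f = trans (cong (f Fin.zero +_) (∑-↑ m (f ∘ Fin.suc))) (sym (+-assoc (f Fin.zero) _ _))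

∑-combine : ∀ m {k} (f : Fin (m * k) → ℕ) → ∑[ i < m * k ] f i ≡ ∑[ g < m ] ∑[ j < k ] f (combine g j)
∑-combine zero f = refl
∑-combine (suc m) {k} f =
  trans (∑-↑ k f) (cong (∑[ j < k ] f (j ↑ˡ (m * k)) +_) (∑-combine m (f ∘ (k ↑ʳ_))))

∣p∣≡∑ : ∀ {n} (p : Subset n) → ∣ p ∣ ≡ ∑[ i < n ] 𝟙 (lookup p i)
∣p∣≡∑ [] = refl
∣p∣≡∑ (true ∷ p) = cong suc (∣p∣≡∑ p)
∣p∣≡∑ (false ∷ p) = ∣p∣≡∑ p

∣p∣≡∑∑ : ∀ {m k} (p : Subset (m * k)) → ∣ p ∣ ≡ ∑[ j < k ] ∑[ g < m ] 𝟙 (lookup p (combine g j))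
∣p∣≡∑∑ {m} {k} p =
  trans (∣p∣≡∑ p) (trans (∑-combine m _) (∑-comm {m} {k} λ g j → 𝟙 (lookup p (combine g j))))

⌊n/2⌋≡n/2 : ∀ n → ⌊ n /2⌋ ≡ n / 2
⌊n/2⌋≡n/2 0 = refl
⌊n/2⌋≡n/2 1 = refl
⌊n/2⌋≡n/2 (suc (suc n)) =
  trans (cong suc (⌊n/2⌋≡n/2 n)) (sym (m/n≡1+[m∸n]/n {suc (suc n)} {2} (s≤s (s≤s z≤n))))

⌈n/2⌉≡[n+1]/2 : ∀ n → ⌈ n /2⌉ ≡ (n + 1) / 2
⌈n/2⌉≡[n+1]/2 n = trans (⌊n/2⌋≡n/2 (suc n)) (cong (_/ 2) (+-comm 1 n))

n≤m+m⇒⌈n/2⌉≤m : ∀ {n m} → n ≤ m + m → ⌈ n /2⌉ ≤ m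
n≤m+m⇒⌈n/2⌉≤m {m = m} n≤2m = ≤-trans (⌈n/2⌉-mono n≤2m) (≤-reflexive (sym (n≡⌈n+n/2⌉ m)))

even : ℕ → Bool
even 0 = true
even 1 = false
even (suc (suc n)) = even n

odd⇒suc-even : ∀ x → even x ≡ false → ∃[ m ] (x ≡ suc m × even m ≡ true)
odd⇒suc-even 1 _ = 0 , refl , refl
odd⇒suc-even (suc (suc x)) odd with odd⇒suc-even x odd
... | m , refl , even-m = suc (suc m) , refl , even-m

∑-even : ∀ n → ∑[ j < n ] 𝟙 (even (toℕ j)) ≡ ⌈ n /2⌉
∑-even 0 = refl
∑-even 1 = refl
∑-even (suc (suc n)) = cong suc (∑-even n)

DisjunctivelyDominated : ∀ {N} → Graph N → Subset N → Fin N → Set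
DisjunctivelyDominated G S v =
  (∃[ u ] (u ∈ S × DistEq G 1 v u))
  ⊎ (∃[ u ] ∃[ w ] (u ≢ w × u ∈ S × w ∈ S × DistEq G 2 v u × DistEq G 2 v w))

module _ {N} {G : Graph N} where

  distLe₁ : ∀ {v u} → DistLe G 1 v u → v ≡ u ⊎ Adj G v u
  distLe₁ (zero , _ , []) = inj₁ refl
  distLe₁ (suc zero , _ , v∼u ∷ []) = inj₂ v∼u
  distLe₁ (suc (suc _) , s≤s () , _)

  distLe₂ : ∀ {v u} → DistLe G 2 v u → v ≡ u ⊎ Adj G v u ⊎ ∃[ w ] (Adj G v w × Adj G w u)
  distLe₂ (zero , _ , []) = inj₁ refl
  distLe₂ (suc zero , _ , v∼u ∷ []) = inj₂ (inj₁ v∼u)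
  distLe₂ (suc (suc zero) , _ , v∼w ∷ (w∼u ∷ [])) = inj₂ (inj₂ (_ , v∼w , w∼u))
  distLe₂ (suc (suc (suc _)) , s≤s (s≤s ()) , _)

  distEq₁ : ∀ {v u} → Adj G v u → v ≢ u → DistEq G 1 v u
  distEq₁ v∼u v≢u = (1 , s≤s z≤n , v∼u ∷ []) , λ where (zero , _ , []) → v≢u refl

  distEq₂ : ∀ {v w u} → Adj G v w → Adj G w u → v ≢ u → ¬ Adj G v u → DistEq G 2 v u
  distEq₂ v∼w w∼u v≢u v≁u = (2 , s≤s (s≤s z≤n) , v∼w ∷ (w∼u ∷ [])) , [ v≢u , v≁u ]′ ∘ distLe₁

module Product {m n} (G : Graph m) (H : Graph n) where

  private
    _∼_ : Fin m × Fin n → Fin m × Fin n → Set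
    (g , h) ∼ (g′ , h′) = (g ≡ g′ × Adj H h h′) ⊎ (h ≡ h′ × Adj G g g′)

    □-adj : ∀ {g h g′ h′} → (g , h) ∼ (g′ , h′) → Adj (G □ H) (combine g h) (combine g′ h′)
    □-adj {g} {h} {g′} {h′} = subst₂ _∼_ (sym (remQuot-combine g h)) (sym (remQuot-combine g′ h′))

  □-adjˡ : ∀ {g g′ : Fin m} {h : Fin n} → Adj G g g′ → Adj (G □ H) (combine g h) (combine g′ h)
  □-adjˡ g∼g′ = □-adj (inj₂ (refl , g∼g′))

  □-adjʳ : ∀ {g : Fin m} {h h′ : Fin n} → Adj H h h′ → Adj (G □ H) (combine g h) (combine g h′)
  □-adjʳ h∼h′ = □-adj (inj₁ (refl , h∼h′))

  □-adj⁻ : ∀ {g h v} → Adj (G □ H) (combine g h) v →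
           ∃[ g′ ] ∃[ h′ ] (v ≡ combine g′ h′ × ((g ≡ g′ × Adj H h h′) ⊎ (h ≡ h′ × Adj G g g′)))
  □-adj⁻ {g} {h} {v} v∼u = quotient {m} n v , remainder {m} n v , sym (combine-remQuot {m} n v)
                        , subst (_∼ remQuot n v) (remQuot-combine g h) v∼u

  □-nonadj : ∀ {g h g′ h′} → g ≢ g′ → h ≢ h′ → ¬ Adj (G □ H) (combine g h) (combine g′ h′)
  □-nonadj {g} {h} {g′} {h′} g≢g′ h≢h′ v∼u with □-adj⁻ {g} {h} v∼u
  ... | _ , _ , e , inj₁ (refl , _) = g≢g′ (sym (combine-injectiveˡ g′ h′ g _ e))
  ... | _ , _ , e , inj₂ (refl , _) = h≢h′ (sym (combine-injectiveʳ g′ h′ _ h e))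

cycle₃-complete : ∀ {g g′ : Fin 3} → g ≢ g′ → CycleAdj 3 g g′
cycle₃-complete {0F} {0F} g≢g′ = contradiction refl g≢g′
cycle₃-complete {0F} {1F} _ = inj₁ refl
cycle₃-complete {0F} {2F} _ = inj₂ (inj₂ (inj₂ (refl , refl)))
cycle₃-complete {1F} {0F} _ = inj₂ (inj₁ refl)
cycle₃-complete {1F} {1F} g≢g′ = contradiction refl g≢g′
cycle₃-complete {1F} {2F} _ = inj₁ refl
cycle₃-complete {2F} {0F} _ = inj₂ (inj₂ (inj₁ (refl , refl)))
cycle₃-complete {2F} {1F} _ = inj₂ (inj₁ refl)
cycle₃-complete {2F} {2F} g≢g′ = contradiction refl g≢g′

module _ {n} .{{_ : NonZero n}} where

  next : Fin n → Fin n
  next i = suc (toℕ i) mod n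

  toℕ-mod : ∀ x → toℕ (x mod n) ≡ x % n
  toℕ-mod x = toℕ-fromℕ< (m%n<n x n)

  toℕ-next : ∀ i → (suc (toℕ i) < n × toℕ (next i) ≡ suc (toℕ i))
                  ⊎ (suc (toℕ i) ≡ n × toℕ (next i) ≡ 0)
  toℕ-next i with m≤n⇒m<n∨m≡n (toℕ<n i)
  ... | inj₁ 1+i<n = inj₁ (1+i<n , trans (toℕ-mod _) (m<n⇒m%n≡m 1+i<n))
  ... | inj₂ 1+i≡n = inj₂ (1+i≡n , trans (toℕ-mod _) (trans (cong (_% n) 1+i≡n) (n%n≡0 n)))

  cycle-adj-next : ∀ i → CycleAdj n i (next i)
  cycle-adj-next i with toℕ-next i
  ... | inj₁ (_ , e) = inj₁ (sym e)
  ... | inj₂ e = inj₂ (inj₂ (inj₁ e))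

  ≡-next : ∀ {i j} → (suc (toℕ i) ≡ toℕ j) ⊎ (suc (toℕ i) ≡ n × toℕ j ≡ 0) → j ≡ next i
  ≡-next {i} {j} i∼j with i∼j | toℕ-next i
  ... | inj₁ e | inj₁ (_ , e′) = toℕ-injective (trans (sym e) (sym e′))
  ... | inj₁ e | inj₂ (e′ , _) = ⊥-elim (<-irrefl (trans (sym e) e′) (toℕ<n j))
  ... | inj₂ (e , _) | inj₁ (1+i<n , _) = ⊥-elim (<-irrefl e 1+i<n)
  ... | inj₂ (_ , z) | inj₂ (_ , z′) = toℕ-injective (trans z (sym z′))

  cycle-adj⁻ : ∀ {i j} → CycleAdj n i j → j ≡ next i ⊎ i ≡ next j
  cycle-adj⁻ (inj₁ e) = inj₁ (≡-next (inj₁ e))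
  cycle-adj⁻ (inj₂ (inj₁ e)) = inj₂ (≡-next (inj₁ e))
  cycle-adj⁻ (inj₂ (inj₂ (inj₁ e))) = inj₁ (≡-next (inj₂ e))
  cycle-adj⁻ (inj₂ (inj₂ (inj₂ e))) = inj₂ (≡-next (inj₂ e))

  next-injective : ∀ {i j} → next i ≡ next j → i ≡ j
  next-injective {i} {j} e with toℕ-next i | toℕ-next j
  ... | inj₁ (_ , a) | inj₁ (_ , b) = toℕ-injective (suc-injective (trans (sym a) (trans (cong toℕ e) b)))
  ... | inj₁ (_ , a) | inj₂ (_ , b) = contradiction (trans (sym a) (trans (cong toℕ e) b)) λ ()
  ... | inj₂ (_ , a) | inj₁ (_ , b) = contradiction (trans (sym b) (trans (cong toℕ (sym e)) a)) λ ()
  ... | inj₂ (a , _) | inj₂ (b , _) = toℕ-injective (suc-injective (trans a (sym b)))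

  mod-toℕ : ∀ i → toℕ i mod n ≡ i
  mod-toℕ i = toℕ-injective (trans (toℕ-mod (toℕ i)) (m<n⇒m%n≡m (toℕ<n i)))

  mod-periodic : ∀ x → (x + n) mod n ≡ x mod n
  mod-periodic x = toℕ-injective (trans (toℕ-mod (x + n)) (trans ([m+n]%n≡m%n x n) (sym (toℕ-mod x))))

  suc-mod : ∀ x → suc x mod n ≡ next (x mod n)
  suc-mod x = toℕ-injective (begin
    toℕ (suc x mod n)         ≡⟨ toℕ-mod (suc x) ⟩
    (1 + x) % n               ≡⟨ %-distribˡ-+ 1 x n ⟩
    (1 % n + x % n) % n       ≡⟨ cong (λ r → (1 % n + r) % n) (m%n%n≡m%n x n) ⟨
    (1 % n + x % n % n) % n   ≡⟨ %-distribˡ-+ 1 (x % n) n ⟨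
    suc (x % n) % n           ≡⟨ cong (λ r → suc r % n) (toℕ-mod x) ⟨
    suc (toℕ (x mod n)) % n   ≡⟨ toℕ-mod (suc (toℕ (x mod n))) ⟨
    toℕ (next (x mod n))      ∎)
    where open ≡-Reasoning

-- Which of the three cells of a column of C₃ □ Cₙ lie in S.
Column : Set
Column = Bool × Bool × Bool

row : Fin 3 → Column → Bool
row 0F (a , _ , _) = a
row 1F (_ , b , _) = b
row 2F (_ , _ , c) = c

bits : Column → List Bool
bits (a , b , c) = a ∷ₗ b ∷ₗ c ∷ₗ []ₗ

size : Column → ℕ
size (a , b , c) = 𝟙 a + 𝟙 b + 𝟙 c

size≡∑ : ∀ c → size c ≡ ∑[ g < 3 ] 𝟙 (row g c)
size≡∑ (a , b , c) =
  trans (+-assoc (𝟙 a) (𝟙 b) (𝟙 c)) (cong (λ r → 𝟙 a + (𝟙 b + r)) (sym (+-identityʳ (𝟙 c))))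

-- In a window of five consecutive columns c₀ … c₄, the occupancy of the cells
-- within distance 1 and 2 of the cell in row g of the middle column.
window-ball₁ : Fin 3 → Column → Column → Column → List Bool
window-ball₁ g c₁ c₂ c₃ = row g c₁ ∷ₗ bits c₂ ++ row g c₃ ∷ₗ []ₗ

window-ball₂ : Fin 3 → Column → Column → Column → Column → Column → List Bool
window-ball₂ g c₀ c₁ c₂ c₃ c₄ = bits c₁ ++ bits c₂ ++ bits c₃ ++ row g c₀ ∷ₗ row g c₄ ∷ₗ []ₗ

-- Weaker than disjunctive domination of the middle cell: distances are bounded
-- rather than exact, and a cell of S counts towards its own ball.
Dominated : Fin 3 → Column → Column → Column → Column → Column → Set
Dominated g c₀ c₁ c₂ c₃ c₄ =
  1 ≤ ones (window-ball₁ g c₁ c₂ c₃) ⊎ 2 ≤ ones (window-ball₂ g c₀ c₁ c₂ c₃ c₄)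

-- The least potential for which potential-step holds, found by a longest-path
-- search over the 8⁴ states: the largest sum of 1 - 2 |c| over the columns c
-- appended along a sequence of dominated windows ending in c₀ c₁ c₂ c₃.
potential : Column → Column → Column → Column → ℕ
potential (a , b , c) c₁ c₂ c₃ = φ (a ∨ b ∨ c) (size c₁ ⊓ 2) (size c₂ ⊓ 2) (size c₃ ⊓ 2)
  where
  φ : Bool → ℕ → ℕ → ℕ → ℕ
  φ false 0 1 0 = 2
  φ false 0 2 0 = 1
  φ false 1 0 0 = 3
  φ false 1 0 1 = 1
  φ false 1 1 0 = 1
  φ false 1 2 0 = 1
  φ false 2 0 0 = 2
  φ false 2 1 0 = 1
  φ false 2 2 0 = 1
  φ true  0 0 0 = 3
  φ true  0 0 1 = 1
  φ true  0 1 0 = 2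
  φ true  0 2 0 = 1
  φ true  1 0 0 = 2
  φ true  1 1 0 = 1
  φ true  1 2 0 = 1
  φ true  2 0 0 = 2
  φ true  2 1 0 = 1
  φ true  2 2 0 = 1
  φ _     _ _ _ = 0

private
  dominated? : Fin 3 → Column → Column → Column → Column → Column → Bool
  dominated? g c₀ c₁ c₂ c₃ c₄ =
    (1 ≤ᵇ ones (window-ball₁ g c₁ c₂ c₃)) ∨ (2 ≤ᵇ ones (window-ball₂ g c₀ c₁ c₂ c₃ c₄))

  valid? : Column → Column → Column → Column → Column → Bool
  valid? c₀ c₁ c₂ c₃ c₄ =
    dominated? 0F c₀ c₁ c₂ c₃ c₄ ∧ dominated? 1F c₀ c₁ c₂ c₃ c₄ ∧ dominated? 2F c₀ c₁ c₂ c₃ c₄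

  decreases? : Column → Column → Column → Column → Column → Bool
  decreases? c₀ c₁ c₂ c₃ c₄ =
    suc (potential c₀ c₁ c₂ c₃) ≤ᵇ size c₄ + size c₄ + potential c₁ c₂ c₃ c₄

  -- decreases? is tested first: it fails on only 41 windows, so valid? is rarely evaluated.
  window-check : Column → Column → Column → Column → Column → Bool
  window-check c₀ c₁ c₂ c₃ c₄ = decreases? c₀ c₁ c₂ c₃ c₄ ∨ not (valid? c₀ c₁ c₂ c₃ c₄)

  every : (Bool → Bool) → Bool
  every q = q false ∧ q true

  every-sound : ∀ q → T (every q) → ∀ x → T (q x)
  every-sound q t false = proj₁ (Equivalence.to T-∧ t)
  every-sound q t true = proj₂ (Equivalence.to T-∧ t)

  everyColumn : (Column → Bool) → Bool
  everyColumn p = every λ a → every λ b → every λ c → p (a , b , c)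

  everyColumn-sound : ∀ p → T (everyColumn p) → ∀ c → T (p c)
  everyColumn-sound p t (a , b , c) =
    every-sound (λ c → p (a , b , c)) (every-sound (λ b → every λ c → p (a , b , c))
      (every-sound (λ a → every λ b → every λ c → p (a , b , c)) t a) b) c

  -- Opaque, so that the exhaustive evaluation happens once, in every-window-passes,
  -- and not whenever Agda compares types mentioning every₅.
  opaque
    every₅ : (Column → Column → Column → Column → Column → Bool) → Bool
    every₅ p = everyColumn λ c₀ → everyColumn λ c₁ → everyColumn λ c₂ → everyColumn λ c₃ →
               everyColumn (p c₀ c₁ c₂ c₃)

  opaque
    unfolding every₅

    every₅-sound : ∀ p → T (every₅ p) → ∀ c₀ c₁ c₂ c₃ c₄ → T (p c₀ c₁ c₂ c₃ c₄)
    every₅-sound p t c₀ c₁ c₂ c₃ =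
      everyColumn-sound (p c₀ c₁ c₂ c₃) (everyColumn-sound (λ c₃ → everyColumn (p c₀ c₁ c₂ c₃))
        (everyColumn-sound (λ c₂ → everyColumn λ c₃ → everyColumn (p c₀ c₁ c₂ c₃))
          (everyColumn-sound (λ c₁ → everyColumn λ c₂ → everyColumn λ c₃ → everyColumn (p c₀ c₁ c₂ c₃))
            (everyColumn-sound (λ c₀ → everyColumn λ c₁ → everyColumn λ c₂ → everyColumn λ c₃ →
                                       everyColumn (p c₀ c₁ c₂ c₃))
              t c₀) c₁) c₂) c₃)

    every-window-passes : T (every₅ window-check)
    every-window-passes = tt

  modus-ponens : ∀ a b → T (b ∨ not a) → T a → T b
  modus-ponens _ true _ _ = tt
  modus-ponens true false () _
  modus-ponens false false _ ()

potential-step : ∀ c₀ c₁ c₂ c₃ c₄ → (∀ g → Dominated g c₀ c₁ c₂ c₃ c₄) →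
                 suc (potential c₀ c₁ c₂ c₃) ≤ size c₄ + size c₄ + potential c₁ c₂ c₃ c₄
potential-step c₀ c₁ c₂ c₃ c₄ dom =
  ≤ᵇ⇒≤ (suc (potential c₀ c₁ c₂ c₃)) (size c₄ + size c₄ + potential c₁ c₂ c₃ c₄)
    (modus-ponens (valid? c₀ c₁ c₂ c₃ c₄) (decreases? c₀ c₁ c₂ c₃ c₄)
      (every₅-sound window-check every-window-passes c₀ c₁ c₂ c₃ c₄)
      (Equivalence.from T-∧ (dominated?-sound 0F , Equivalence.from T-∧ (dominated?-sound 1F , dominated?-sound 2F))))
  where
  dominated?-sound : ∀ g → T (dominated? g c₀ c₁ c₂ c₃ c₄)
  dominated?-sound g = Equivalence.from T-∨ (⊎-map ≤⇒≤ᵇ ≤⇒≤ᵇ (dom g))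

Torus : (n : ℕ) → Graph (3 * n)
Torus n = Cycle 3 □ Cycle n

module Cells {n} .{{_ : NonZero n}} where
  open Product (Cycle 3) (Cycle n)

  cell : Fin 3 → ℕ → Fin (3 * n)
  cell g x = combine g (x mod n)

  cell-neighbour : ∀ {g x u} → Adj (Torus n) (cell g (suc x)) u →
                   u ≡ cell g x ⊎ u ≡ cell g (2 + x) ⊎ ∃[ g′ ] u ≡ cell g′ (suc x)
  cell-neighbour {g} {x} g∼u with □-adj⁻ {g} {suc x mod n} g∼u
  ... | g′ , _ , refl , inj₂ (refl , _) = inj₂ (inj₂ (g′ , refl))
  ... | _ , h′ , refl , inj₁ (refl , x∼h′) with cycle-adj⁻ x∼h′
  ...   | inj₁ refl = inj₂ (inj₁ (cong (combine g) (sym (suc-mod (suc x)))))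
  ...   | inj₂ e = inj₁ (cong (combine g) (next-injective (trans (sym e) (suc-mod x))))

  cells : ℕ → List (Fin (3 * n))
  cells y = cell 0F y ∷ₗ cell 1F y ∷ₗ cell 2F y ∷ₗ []ₗ

  ∈-cells : ∀ g {y} → cell g y ∈ₗ cells y
  ∈-cells 0F = here refl
  ∈-cells 1F = there (here refl)
  ∈-cells 2F = there (there (here refl))

  ball₁ : Fin 3 → ℕ → List (Fin (3 * n))
  ball₁ g x = cell g (1 + x) ∷ₗ cells (2 + x) ++ cell g (3 + x) ∷ₗ []ₗ

  ball₂ : Fin 3 → ℕ → List (Fin (3 * n))
  ball₂ g x = cells (1 + x) ++ cells (2 + x) ++ cells (3 + x) ++ cell g x ∷ₗ cell g (4 + x) ∷ₗ []ₗ

  ∈-ball₁ : ∀ {g x u} → DistLe (Torus n) 1 (cell g (2 + x)) u → u ∈ₗ ball₁ g x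
  ∈-ball₁ {g} {x} d with distLe₁ d
  ... | inj₁ refl = there (∈-++⁺ˡ (∈-cells g))
  ... | inj₂ g∼u with cell-neighbour {g} {suc x} g∼u
  ...   | inj₁ refl = here refl
  ...   | inj₂ (inj₁ refl) = there (∈-++⁺ʳ (cells (2 + x)) (here refl))
  ...   | inj₂ (inj₂ (g′ , refl)) = there (∈-++⁺ˡ (∈-cells g′))

  ∈-ball₂ : ∀ {g x u} → DistLe (Torus n) 2 (cell g (2 + x)) u → u ∈ₗ ball₂ g x
  ∈-ball₂ {g} {x} d = reach (distLe₂ d)
    where
    column₁ : ∀ g′ → cell g′ (1 + x) ∈ₗ ball₂ g x
    column₁ g′ = ∈-++⁺ˡ (∈-cells g′)

    column₂ : ∀ g′ → cell g′ (2 + x) ∈ₗ ball₂ g x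
    column₂ g′ = ∈-++⁺ʳ (cells (1 + x)) (∈-++⁺ˡ (∈-cells g′))

    column₃ : ∀ g′ → cell g′ (3 + x) ∈ₗ ball₂ g x
    column₃ g′ = ∈-++⁺ʳ (cells (1 + x)) (∈-++⁺ʳ (cells (2 + x)) (∈-++⁺ˡ (∈-cells g′)))

    ends : ∀ {u} → u ∈ₗ cell g x ∷ₗ cell g (4 + x) ∷ₗ []ₗ → u ∈ₗ ball₂ g x
    ends = ∈-++⁺ʳ (cells (1 + x)) ∘ ∈-++⁺ʳ (cells (2 + x)) ∘ ∈-++⁺ʳ (cells (3 + x))

    from₁ : ∀ {u} → u ≡ cell g x ⊎ u ≡ cell g (2 + x) ⊎ ∃[ g′ ] u ≡ cell g′ (1 + x) →
            u ∈ₗ ball₂ g x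
    from₁ (inj₁ refl) = ends (here refl)
    from₁ (inj₂ (inj₁ refl)) = column₂ g
    from₁ (inj₂ (inj₂ (g′ , refl))) = column₁ g′

    from₂ : ∀ {g′ u} → u ≡ cell g′ (1 + x) ⊎ u ≡ cell g′ (3 + x) ⊎ ∃[ g″ ] u ≡ cell g″ (2 + x) →
            u ∈ₗ ball₂ g x
    from₂ {g′} (inj₁ refl) = column₁ g′
    from₂ {g′} (inj₂ (inj₁ refl)) = column₃ g′
    from₂ (inj₂ (inj₂ (g″ , refl))) = column₂ g″

    from₃ : ∀ {u} → u ≡ cell g (2 + x) ⊎ u ≡ cell g (4 + x) ⊎ ∃[ g′ ] u ≡ cell g′ (3 + x) →
            u ∈ₗ ball₂ g x
    from₃ (inj₁ refl) = column₂ g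
    from₃ (inj₂ (inj₁ refl)) = ends (there (here refl))
    from₃ (inj₂ (inj₂ (g′ , refl))) = column₃ g′

    reach : ∀ {u} → cell g (2 + x) ≡ u ⊎ Adj (Torus n) (cell g (2 + x)) u
                    ⊎ ∃[ w ] (Adj (Torus n) (cell g (2 + x)) w × Adj (Torus n) w u) →
            u ∈ₗ ball₂ g x
    reach (inj₁ refl) = column₂ g
    reach (inj₂ (inj₁ g∼u)) = from₂ {g} (cell-neighbour {g} {suc x} g∼u)
    reach (inj₂ (inj₂ (w , g∼w , w∼u))) with cell-neighbour {g} {suc x} g∼w
    ... | inj₁ refl = from₁ (cell-neighbour {g} {x} w∼u)
    ... | inj₂ (inj₁ refl) = from₃ (cell-neighbour {g} {2 + x} w∼u)
    ... | inj₂ (inj₂ (g′ , refl)) = from₂ {g′} (cell-neighbour {g′} {suc x} w∼u)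

module LowerBound {n} .{{_ : NonZero n}} (S : Subset (3 * n)) where
  open Cells {n}

  private
    at : Fin n → Column
    at j = occupied 0F , occupied 1F , occupied 2F
      where
      occupied : Fin 3 → Bool
      occupied g = lookup S (combine g j)

  occupancy : ℕ → Column
  occupancy x = at (x mod n)

  occupancy-periodic : ∀ x → occupancy (x + n) ≡ occupancy x
  occupancy-periodic x = cong at (mod-periodic x)

  ∣S∣≡∑size : ∣ S ∣ ≡ ∑[ j < n ] size (occupancy (toℕ j))
  ∣S∣≡∑size = trans (∣p∣≡∑∑ {3} {n} S) (sum-cong-≗ {n} λ j →
    trans (sym (size≡∑ (at j))) (cong (size ∘ at) (sym (mod-toℕ j))))

  ball₁-occupancy : ∀ g x → map (lookup S) (ball₁ g x) ≡
                    window-ball₁ g (occupancy (1 + x)) (occupancy (2 + x)) (occupancy (3 + x))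
  ball₁-occupancy 0F x = refl
  ball₁-occupancy 1F x = refl
  ball₁-occupancy 2F x = refl

  ball₂-occupancy : ∀ g x → map (lookup S) (ball₂ g x) ≡
                    window-ball₂ g (occupancy x) (occupancy (1 + x)) (occupancy (2 + x))
                                   (occupancy (3 + x)) (occupancy (4 + x))
  ball₂-occupancy 0F x = refl
  ball₂-occupancy 1F x = refl
  ball₂-occupancy 2F x = refl

  window-dominated : Disjunctive (Torus n) S → ∀ g x →
              Dominated g (occupancy x) (occupancy (1 + x)) (occupancy (2 + x)) (occupancy (3 + x)) (occupancy (4 + x))
  window-dominated D g x =
    subst₂ (λ b₁ b₂ → 1 ≤ ones b₁ ⊎ 2 ≤ ones b₂) (ball₁-occupancy g x) (ball₂-occupancy g x) in-balls
    where
    in-balls : 1 ≤ ones (map (lookup S) (ball₁ g x)) ⊎ 2 ≤ ones (map (lookup S) (ball₂ g x))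
    in-balls with cell g (2 + x) ∈? S
    ... | yes v∈S =
      inj₁ (∈⇒1≤ones (lookup S) {xs = ball₁ g x} (there (∈-++⁺ˡ (∈-cells g))) ([]=⇒lookup v∈S))
    ... | no v∉S with D (cell g (2 + x)) v∉S
    ...   | inj₁ (u , u∈S , d , _) = inj₁ (∈⇒1≤ones (lookup S) (∈-ball₁ {g} {x} d) ([]=⇒lookup u∈S))
    ...   | inj₂ (u , w , u≢w , u∈S , w∈S , (du , _) , (dw , _)) =
            inj₂ (∈∈⇒2≤ones (lookup S) (∈-ball₂ {g} {x} du) (∈-ball₂ {g} {x} dw) u≢w
                                       ([]=⇒lookup u∈S) ([]=⇒lookup w∈S))

  lower-bound : Disjunctive (Torus n) S → n ≤ ∣ S ∣ + ∣ S ∣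
  lower-bound D = begin
    n                                                    ≤⟨ potential-argument n ψ c ψ-periodic step ⟩
    ∑[ j < n ] c (toℕ j)                                 ≡⟨ ∑-distrib-+ {n} (s ∘ (4 +_) ∘ toℕ) (s ∘ (4 +_) ∘ toℕ) ⟩
    ∑[ j < n ] s (4 + toℕ j) + ∑[ j < n ] s (4 + toℕ j)  ≡⟨ cong (λ t → t + t) (∑-shift s-periodic 4) ⟩
    ∑[ j < n ] s (toℕ j) + ∑[ j < n ] s (toℕ j)          ≡⟨ cong (λ t → t + t) ∣S∣≡∑size ⟨
    ∣ S ∣ + ∣ S ∣                                        ∎
    where
    open ≤-Reasoning

    s : ℕ → ℕ
    s = size ∘ occupancy

    s-periodic : Periodic n s
    s-periodic = cong size ∘ occupancy-periodic

    c : ℕ → ℕ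
    c x = s (4 + x) + s (4 + x)

    ψ : ℕ → ℕ
    ψ x = potential (occupancy x) (occupancy (1 + x)) (occupancy (2 + x)) (occupancy (3 + x))

    ψ-periodic : ψ n ≡ ψ 0
    ψ-periodic = cong₄ (occupancy-periodic 0) (occupancy-periodic 1) (occupancy-periodic 2) (occupancy-periodic 3)
      where
      cong₄ : ∀ {a a′ b b′ c c′ d d′} → a ≡ a′ → b ≡ b′ → c ≡ c′ → d ≡ d′ →
              potential a b c d ≡ potential a′ b′ c′ d′
      cong₄ refl refl refl refl = refl

    step : ∀ x → suc (ψ x) ≤ c x + ψ (suc x)
    step x = potential-step (occupancy x) (occupancy (1 + x)) (occupancy (2 + x)) (occupancy (3 + x)) (occupancy (4 + x))
                            (λ g → window-dominated D g x)

module UpperBound {n} .{{_ : NonZero n}} where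
  open Product (Cycle 3) (Cycle n)

  inS₀ : Fin 3 → Fin n → Bool
  inS₀ 0F j = even (toℕ j)
  inS₀ (Fin.suc _) _ = false

  row₀ : Fin n → Fin (3 * n)
  row₀ = combine {3} 0F

  row₀-injective : ∀ {j j′} → row₀ j ≡ row₀ j′ → j ≡ j′
  row₀-injective {j} {j′} = combine-injectiveʳ {3} 0F j 0F j′

  S₀ : Subset (3 * n)
  S₀ = tabulate (uncurry inS₀ ∘ remQuot n)

  lookup-S₀ : ∀ g j → lookup S₀ (combine g j) ≡ inS₀ g j
  lookup-S₀ g j = trans (lookup∘tabulate _ (combine g j)) (cong (uncurry inS₀) (remQuot-combine g j))

  ∈S₀ : ∀ g j → inS₀ g j ≡ true → combine g j ∈ S₀
  ∈S₀ g j e = lookup⇒[]= (combine g j) S₀ (trans (lookup-S₀ g j) e)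

  ∣S₀∣ : ∣ S₀ ∣ ≡ ⌈ n /2⌉
  ∣S₀∣ = begin
    ∣ S₀ ∣                                               ≡⟨ ∣p∣≡∑∑ {3} {n} S₀ ⟩
    ∑[ j < n ] ∑[ g < 3 ] 𝟙 (lookup S₀ (combine g j))   ≡⟨ sum-cong-≗ {n} (λ j → sum-cong-≗ {3} λ g →
                                                                           cong 𝟙 (lookup-S₀ g j)) ⟩
    ∑[ j < n ] (𝟙 (even (toℕ j)) + 0)                    ≡⟨ sum-cong-≗ {n} (+-identityʳ ∘ 𝟙 ∘ even ∘ toℕ) ⟩
    ∑[ j < n ] 𝟙 (even (toℕ j))                          ≡⟨ ∑-even n ⟩
    ⌈ n /2⌉                                              ∎
    where open ≡-Reasoning

  private
    module Odd {j : Fin n} {m} (j≡1+m : toℕ j ≡ suc m) (even-m : even m ≡ true) where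

      prev : Fin n
      prev = fromℕ< (<⇒≤ (subst (_< n) j≡1+m (toℕ<n j)))

      toℕ-prev : toℕ prev ≡ m
      toℕ-prev = toℕ-fromℕ< _

      prev∈S₀ : row₀ prev ∈ S₀
      prev∈S₀ = ∈S₀ 0F prev (trans (cong even toℕ-prev) even-m)

      next∈S₀ : row₀ (next j) ∈ S₀
      next∈S₀ with toℕ-next j
      ... | inj₁ (_ , e) = ∈S₀ 0F (next j) (trans (cong even (trans e (cong suc j≡1+m))) even-m)
      ... | inj₂ (_ , e) = ∈S₀ 0F (next j) (cong even e)

      row₀-prev : Adj (Torus n) (row₀ j) (row₀ prev)
      row₀-prev = □-adjʳ {0F} {j} {prev} (inj₂ (inj₁ (trans (cong suc toℕ-prev) (sym j≡1+m))))

      row₀-next : Adj (Torus n) (row₀ j) (row₀ (next j))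
      row₀-next = □-adjʳ {0F} {j} {next j} (cycle-adj-next j)

      j≢prev : j ≢ prev
      j≢prev j≡prev = m≢1+n+m m {0} (trans (sym toℕ-prev) (trans (cong toℕ (sym j≡prev)) j≡1+m))

      j≢next : j ≢ next j
      j≢next j≡next with toℕ-next j
      ... | inj₁ (_ , e) = 1+n≢n (sym (trans (cong toℕ j≡next) e))
      ... | inj₂ (_ , e) = contradiction (trans (sym j≡1+m) (trans (cong toℕ j≡next) e)) λ ()

      -- The only use of 3 ≤ n: in C₂ the two neighbours of j coincide.
      prev≢next : 3 ≤ n → prev ≢ next j
      prev≢next 3≤n prev≡next with toℕ-next j
      ... | inj₁ (_ , e) =
        m≢1+n+m m {1} (trans (sym toℕ-prev) (trans (cong toℕ prev≡next) (trans e (cong suc j≡1+m))))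
      ... | inj₂ (1+j≡n , e) with trans (sym toℕ-prev) (trans (cong toℕ prev≡next) e)
      ...   | refl = <-irrefl (trans (cong suc (sym j≡1+m)) 1+j≡n) 3≤n

    module OffRow₀ (g : Fin 2) (j : Fin n) where

      to-row₀ : Adj (Torus n) (combine (Fin.suc g) j) (row₀ j)
      to-row₀ = □-adjˡ {Fin.suc g} {0F} {j} (cycle₃-complete λ ())

      ≢row₀ : ∀ {j′} → combine (Fin.suc g) j ≢ row₀ j′
      ≢row₀ {j′} e = contradiction (combine-injectiveˡ (Fin.suc g) j 0F j′ e) λ ()

      ≁row₀ : ∀ {j′} → j ≢ j′ → ¬ Adj (Torus n) (combine (Fin.suc g) j) (row₀ j′)
      ≁row₀ {j′} = □-nonadj {Fin.suc g} {j} {0F} {j′} λ ()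

  S₀-dominates : 3 ≤ n → ∀ (g : Fin 3) (j : Fin n) → combine g j ∉ S₀ →
                 DisjunctivelyDominated (Torus n) S₀ (combine g j)
  S₀-dominates _ 0F j v∉S₀ with even (toℕ j) in even-j
  ... | true = contradiction (∈S₀ 0F j even-j) v∉S₀
  ... | false with odd⇒suc-even (toℕ j) even-j
  ...   | m , j≡1+m , even-m =
          inj₁ (row₀ prev , prev∈S₀ , distEq₁ row₀-prev (j≢prev ∘ row₀-injective))
    where open Odd j≡1+m even-m
  S₀-dominates _ (Fin.suc g) j _ with even (toℕ j) in even-j
  ... | true = inj₁ (row₀ j , ∈S₀ 0F j even-j , distEq₁ to-row₀ ≢row₀)
    where open OffRow₀ g j
  S₀-dominates 3≤n (Fin.suc g) j _ | false with odd⇒suc-even (toℕ j) even-j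
  ... | m , j≡1+m , even-m =
        inj₂ (row₀ prev , row₀ (next j) , prev≢next 3≤n ∘ row₀-injective ,
              prev∈S₀ , next∈S₀ ,
              distEq₂ to-row₀ row₀-prev ≢row₀ (≁row₀ j≢prev) ,
              distEq₂ to-row₀ row₀-next ≢row₀ (≁row₀ j≢next))
    where
    open OffRow₀ g j
    open Odd j≡1+m even-m

  S₀-disjunctive : 3 ≤ n → Disjunctive (Torus n) S₀
  S₀-disjunctive 3≤n v =
    subst (λ v → v ∉ S₀ → DisjunctivelyDominated (Torus n) S₀ v) (combine-remQuot {3} n v)
          (S₀-dominates 3≤n (quotient {3} n v) (remainder {3} n v))

theorem1p2 : (n : ℕ) → 3 ≤ n → DisjDomNumber (Cycle 3 □ Cycle n) ((n + 1) / 2)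
theorem1p2 n@(suc _) 3≤n =
  (S₀ , S₀-disjunctive 3≤n , trans ∣S₀∣ (⌈n/2⌉≡[n+1]/2 n)) ,
  λ S D → subst (_≤ ∣ S ∣) (⌈n/2⌉≡[n+1]/2 n) (n≤m+m⇒⌈n/2⌉≤m (lower-bound S D))
  where
  open UpperBound
  open LowerBound
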